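{- Let $k,m\ge3$, let $G$ be a linear $k$-partite $k$-graph, and let $v_1,\dots,v_{(k-1)m}$ be a sequence of vertices of $G$ (not necessarily distinct) such that the sets $e_i:=\{v_{(k-1)(i-1)+1},\dots,v_{(k-1)i+1}\}$, $i\in\{1,\dots,m\}$, are pairwise distinct edges of $G$, where subscripts are taken modulo $(k-1)m$. Then $G$ has girth at most $m$.
   Context: A $k$-graph is a hypergraph each of whose edges has exactly $k$ vertices; it is $k$-partite if its vertex set can be partitioned into $k$ classes such that each edge contains exactly one vertex of each class; it is linear if any two distinct edges share at most one vertex. For $\ell\ge3$, a loose $\ell$-cycle in a $k$-graph is a sequence of $(k-1)\ell$ distinct vertices $v_1,\dots,v_{(k-1)\ell}$ such that $\{v_{(k-1)(i-1)+1},\dots,v_{(k-1)i+1}\}\in E(G)$ for each $i\in\{1,\dots,\ell\}$, indices taken modulo $(k-1)\ell$. The girth of $G$ is the minimum $\ell$ such that $G$ contains a loose $\ell$-cycle ($\infty$ if there is none). -}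

module Defs where

open import Data.Nat using (ℕ; zero; suc; _+_; _*_; _∸_; _≤_)
open import Data.Nat.DivMod using (_mod_)
open import Data.Fin using (Fin; toℕ)
open import Data.Fin.Subset using (Subset; ⊥; ⁅_⁆; _∪_; _∩_; _∈_; ∣_∣)
open import Data.Product using (Σ; ∃; _×_; _,_)
open import Relation.Binary.PropositionalEquality using (_≡_; _≢_)
open import Function.Definitions using (Injective)

record KGraph (k n : ℕ) : Set₁ where
  field
    Edge    : Subset n → Set
    uniform : ∀ e → Edge e → ∣ e ∣ ≡ k
open KGraph public

IsKPartite : ∀ {k n} → KGraph k n → Set
IsKPartite {k} {n} G =
  Σ (Fin n → Fin k) λ part →
    ∀ e → Edge G e → ∀ (c : Fin k) →
      (Σ (Fin n) λ x → x ∈ e × part x ≡ c) ×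
      (∀ x y → x ∈ e → y ∈ e → part x ≡ c → part y ≡ c → x ≡ y)

IsLinear : ∀ {k n} → KGraph k n → Set
IsLinear G = ∀ e f → Edge G e → Edge G f → e ≢ f → ∣ e ∩ f ∣ ≤ 1

-- A cyclic sequence w_0,…,w_{L-1} (0-based: w_j is v_{j+1} in the paper).
-- cyc w j = { w_(j mod L) }  (empty if L = 0, which never occurs below).
cyc : ∀ {L n} → (Fin L → Fin n) → ℕ → Subset n
cyc {zero}  w j = ⊥
cyc {suc L} w j = ⁅ w (j mod suc L) ⁆

segment : ∀ {L n} → (Fin L → Fin n) → ℕ → ℕ → Subset n
segment w s zero    = ⊥
segment w s (suc r) = cyc w (s + r) ∪ segment w s r

-- With i = i'-1 and w_j = v_{j+1} this is the paper's
-- e_{i'} = { v_((k-1)(i'-1)+1), …, v_((k-1)i'+1) }.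
edgeSet : ∀ {L n} → (k : ℕ) → (Fin L → Fin n) → ℕ → Subset n
edgeSet k w i = segment w ((k ∸ 1) * i) k

HasLooseCycle : ∀ {k n} → KGraph k n → ℕ → Set
HasLooseCycle {k} {n} G ℓ =
  Σ (Fin ((k ∸ 1) * ℓ) → Fin n) λ w →
    Injective _≡_ _≡_ w × (∀ (i : Fin ℓ) → Edge G (edgeSet k w (toℕ i)))

-- girth(G) ≤ m  (girth = least ℓ ≥ 3 with a loose ℓ-cycle, ∞ if none),
-- i.e. G has a loose ℓ-cycle for some 3 ≤ ℓ ≤ m.
GirthAtMost : ∀ {k n} → KGraph k n → ℕ → Set
GirthAtMost G m = ∃ λ ℓ → 3 ≤ ℓ × ℓ ≤ m × HasLooseCycle G ℓ

{-# OPTIONS --safe #-}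
module Submission where

-- The edges e_1, …, e_m form a closed walk: consecutive edges are glued at a
-- junction vertex, and each edge has k − 2 further inner vertices. Listing every
-- junction followed by the inner vertices of the next edge gives a cyclic vertex
-- sequence; if it has no repetition, the walk is a loose cycle, of length at
-- least 3 because two distinct edges of a linear graph cannot share both of
-- their junctions. Otherwise some vertex z lies on edges e_a and e_b (a < b)
-- without being the junction after e_a or the one before e_b. Then e_a, …, e_b,
-- closed up at z, is a shorter closed walk with distinct edges, unless e_a and
-- e_b are the first and the last edge; but then z and the closing junction would
-- be two common vertices of e_a and e_b.

open import Defs
open import Data.Nat using (ℕ; zero; suc; _+_; _*_; _∸_; _≤_; _<_; z≤n; s≤s; z<s; NonZero; >-nonZero; >-nonZero⁻¹)
open import Data.Nat.Properties
open import Data.Nat.DivMod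
open import Data.Nat.Divisibility using (n∣m*n)
open import Data.Nat.Induction using (<-rec)
open import Data.Fin using (Fin; toℕ; fromℕ<) renaming (_≟_ to _≟ᶠ_)
open import Data.Fin.Properties using (toℕ-injective; toℕ-fromℕ<; toℕ<n; fromℕ<-cong; fromℕ<-injective; any?)
open import Data.Fin.Subset using (Subset; ⊥; ⁅_⁆; _∪_; _∈_; _⊆_; ∣_∣; inside; outside)
open import Data.Fin.Subset.Properties
  using (∣⊥∣≡0; ∣⁅x⁆∣≡1; p⊆q⇒∣p∣≤∣q∣; x∈p⇒∣p-x∣<∣p∣; x∈p∧x≢y⇒x∈p-y; x∈p∪q⁻; x∈p∪q⁺; x∈⁅x⁆; x∈⁅y⁆⇒x≡y; ∉⊥; x∈p∩q⁺; ⊆-antisym)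
open import Data.Vec.Base using ([]; _∷_)
open import Data.Product using (∃-syntax; ∃₂; _×_; _,_)
open import Data.Sum using (_⊎_; inj₁; inj₂)
open import Data.Empty using (⊥-elim)
open import Function using (_∘_; id)
open import Function.Definitions using (Injective)
open import Relation.Nullary using (yes; no; contradiction)
open import Relation.Nullary.Decidable using (_×-dec_; ¬?; decidable-stable)
open import Relation.Binary.Definitions using (tri<; tri≈; tri>)
open import Relation.Binary.PropositionalEquality
open ≡-Reasoning

∣p∪q∣≤∣p∣+∣q∣ : ∀ {n} (p q : Subset n) → ∣ p ∪ q ∣ ≤ ∣ p ∣ + ∣ q ∣
∣p∪q∣≤∣p∣+∣q∣ []            []            = z≤n
∣p∪q∣≤∣p∣+∣q∣ (inside  ∷ p) (inside  ∷ q) = s≤s (≤-trans (∣p∪q∣≤∣p∣+∣q∣ p q) (+-monoʳ-≤ ∣ p ∣ (n≤1+n ∣ q ∣)))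
∣p∪q∣≤∣p∣+∣q∣ (inside  ∷ p) (outside ∷ q) = s≤s (∣p∪q∣≤∣p∣+∣q∣ p q)
∣p∪q∣≤∣p∣+∣q∣ (outside ∷ p) (inside  ∷ q) = ≤-trans (s≤s (∣p∪q∣≤∣p∣+∣q∣ p q)) (≤-reflexive (sym (+-suc ∣ p ∣ ∣ q ∣)))
∣p∪q∣≤∣p∣+∣q∣ (outside ∷ p) (outside ∷ q) = ∣p∪q∣≤∣p∣+∣q∣ p q

∣⁅x⁆∪p∣≤1+∣p∣ : ∀ {n} (x : Fin n) (p : Subset n) → ∣ ⁅ x ⁆ ∪ p ∣ ≤ suc ∣ p ∣
∣⁅x⁆∪p∣≤1+∣p∣ x p = ≤-trans (∣p∪q∣≤∣p∣+∣q∣ ⁅ x ⁆ p) (≤-reflexive (cong (_+ ∣ p ∣) (∣⁅x⁆∣≡1 x)))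

x∈p⇒⁅x⁆∪p⊆p : ∀ {n} {x : Fin n} {p : Subset n} → x ∈ p → ⁅ x ⁆ ∪ p ⊆ p
x∈p⇒⁅x⁆∪p⊆p {x = x} {p} x∈p y∈ with x∈p∪q⁻ ⁅ x ⁆ p y∈
... | inj₁ y∈⁅x⁆ = subst (_∈ p) (sym (x∈⁅y⁆⇒x≡y x y∈⁅x⁆)) x∈p
... | inj₂ y∈p   = y∈p

x∈p∧y∈p∧x≢y⇒2≤∣p∣ : ∀ {n} {x y : Fin n} {p : Subset n} → x ∈ p → y ∈ p → x ≢ y → 2 ≤ ∣ p ∣
x∈p∧y∈p∧x≢y⇒2≤∣p∣ x∈p y∈p x≢y =
  ≤-trans (s≤s (≤-trans (s≤s z≤n) (x∈p⇒∣p-x∣<∣p∣ (x∈p∧x≢y⇒x∈p-y y∈p (x≢y ∘ sym))))) (x∈p⇒∣p-x∣<∣p∣ x∈p)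

common-vertex-unique : ∀ {k n} (G : KGraph k n) {e f : Subset n} {x y : Fin n} → IsLinear G →
  Edge G e → Edge G f → e ≢ f → x ∈ e → x ∈ f → y ∈ e → y ∈ f → x ≡ y
common-vertex-unique G {x = x} {y} linear e∈G f∈G e≢f x∈e x∈f y∈e y∈f =
  decidable-stable (x ≟ᶠ y) λ x≢y →
    ≤⇒≯ (linear _ _ e∈G f∈G e≢f) (x∈p∧y∈p∧x≢y⇒2≤∣p∣ (x∈p∩q⁺ (x∈e , x∈f)) (x∈p∩q⁺ (y∈e , y∈f)) x≢y)

injective-or-collision : ∀ {m n} (f : Fin m → Fin n) →
  Injective _≡_ _≡_ f ⊎ ∃₂ λ p q → p ≢ q × f p ≡ f q
injective-or-collision f with any? (λ p → any? (λ q → ¬? (p ≟ᶠ q) ×-dec (f p ≟ᶠ f q)))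
... | yes (p , q , p≢q , fp≡fq) = inj₂ (p , q , p≢q , fp≡fq)
... | no ¬collision = inj₁ λ {p} {q} fp≡fq →
  decidable-stable (p ≟ᶠ q) λ p≢q → ¬collision (p , q , p≢q , fp≡fq)

transpose : ℕ → ℕ → ℕ → ℕ
transpose a b t with t ≟ a | t ≟ b
... | yes _ | _     = b
... | no _  | yes _ = a
... | no _  | no _  = t

transpose-matchˡ : ∀ a b → transpose a b a ≡ b
transpose-matchˡ a b with a ≟ a
... | yes _   = refl
... | no a≢a  = contradiction refl a≢a

transpose-matchʳ : ∀ a b → transpose a b b ≡ a
transpose-matchʳ a b with b ≟ a | b ≟ b
... | yes b≡a | _      = b≡a
... | no _    | yes _  = refl
... | no _    | no b≢b = contradiction refl b≢b

transpose-fix : ∀ {a b t} → t ≢ a → t ≢ b → transpose a b t ≡ t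
transpose-fix {a} {b} {t} t≢a t≢b with t ≟ a | t ≟ b
... | yes t≡a | _       = contradiction t≡a t≢a
... | no _    | yes t≡b = contradiction t≡b t≢b
... | no _    | no _    = refl

transpose-involutive : ∀ a b t → transpose a b (transpose a b t) ≡ t
transpose-involutive a b t with t ≟ a | t ≟ b
... | yes refl | _        = transpose-matchʳ t b
... | no _     | yes refl = transpose-matchˡ a t
... | no t≢a   | no t≢b   = transpose-fix t≢a t≢b

transpose-< : ∀ {a b t r} → a < r → b < r → t < r → transpose a b t < r
transpose-< {a} {b} {t} a<r b<r t<r with t ≟ a | t ≟ b
... | yes _ | _     = b<r
... | no _  | yes _ = a<r
... | no _  | no _  = t<r

image : ∀ {n} → (ℕ → Fin n) → ℕ → Subset n
image f zero    = ⊥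
image f (suc r) = ⁅ f r ⁆ ∪ image f r

module _ {n : ℕ} {f : ℕ → Fin n} where

  ∈-image⁺ : ∀ {r t} → t < r → f t ∈ image f r
  ∈-image⁺ {suc r} t<1+r with m<1+n⇒m<n∨m≡n t<1+r
  ... | inj₁ t<r  = x∈p∪q⁺ (inj₂ (∈-image⁺ t<r))
  ... | inj₂ refl = x∈p∪q⁺ (inj₁ (x∈⁅x⁆ (f r)))

  ∈-image⁻ : ∀ {r x} → x ∈ image f r → ∃[ t ] t < r × x ≡ f t
  ∈-image⁻ {zero} x∈ = ⊥-elim (∉⊥ x∈)
  ∈-image⁻ {suc r} x∈ with x∈p∪q⁻ ⁅ f r ⁆ (image f r) x∈
  ... | inj₁ x∈⁅fr⁆ = r , ≤-refl , x∈⁅y⁆⇒x≡y (f r) x∈⁅fr⁆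
  ... | inj₂ x∈im with ∈-image⁻ x∈im
  ...   | t , t<r , x≡ft = t , m<n⇒m<1+n t<r , x≡ft

  ∣image∣≤ : ∀ r → ∣ image f r ∣ ≤ r
  ∣image∣≤ zero    = ≤-reflexive (∣⊥∣≡0 n)
  ∣image∣≤ (suc r) = ≤-trans (∣⁅x⁆∪p∣≤1+∣p∣ (f r) (image f r)) (s≤s (∣image∣≤ r))

  ∣image∣<-if-collision : ∀ {a b r} → a < b → b < r → f a ≡ f b → ∣ image f r ∣ < r
  ∣image∣<-if-collision {a} {b} {suc r} a<b b<1+r fa≡fb with m<1+n⇒m<n∨m≡n b<1+r
  ... | inj₁ b<r  = s≤s (≤-trans (∣⁅x⁆∪p∣≤1+∣p∣ (f r) (image f r)) (∣image∣<-if-collision a<b b<r fa≡fb))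
  ... | inj₂ refl = s≤s (≤-trans (p⊆q⇒∣p∣≤∣q∣ (x∈p⇒⁅x⁆∪p⊆p fb∈image)) (∣image∣≤ b))
    where
    fb∈image : f b ∈ image f b
    fb∈image = subst (_∈ image f b) fa≡fb (∈-image⁺ a<b)

  injective-if-∣image∣≡ : ∀ {r a b} → ∣ image f r ∣ ≡ r → a < r → b < r → f a ≡ f b → a ≡ b
  injective-if-∣image∣≡ {r} {a} {b} full a<r b<r fa≡fb with <-cmp a b
  ... | tri< a<b _ _ = contradiction (∣image∣<-if-collision a<b b<r fa≡fb) (<-irrefl full)
  ... | tri≈ _ a≡b _ = a≡b
  ... | tri> _ _ b<a = contradiction (∣image∣<-if-collision b<a a<r (sym fa≡fb)) (<-irrefl full)

image-cong : ∀ {n} {f g : ℕ → Fin n} r → (∀ {t} → t < r → f t ≡ g t) → image f r ≡ image g r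
image-cong zero    f≗g = refl
image-cong (suc r) f≗g = cong₂ (λ x p → ⁅ x ⁆ ∪ p) (f≗g ≤-refl) (image-cong r (f≗g ∘ m<n⇒m<1+n))

image-∘-transpose : ∀ {n} (f : ℕ → Fin n) {a b r} → a < r → b < r →
  image (f ∘ transpose a b) r ≡ image f r
image-∘-transpose f {a} {b} {r} a<r b<r = ⊆-antisym ⊆-image ⊇-image
  where
  ⊆-image : image (f ∘ transpose a b) r ⊆ image f r
  ⊆-image x∈ with ∈-image⁻ {f = f ∘ transpose a b} x∈
  ... | t , t<r , refl = ∈-image⁺ (transpose-< a<r b<r t<r)
  ⊇-image : image f r ⊆ image (f ∘ transpose a b) r
  ⊇-image x∈ with ∈-image⁻ {f = f} x∈
  ... | t , t<r , refl = subst (_∈ image (f ∘ transpose a b) r) (cong f (transpose-involutive a b t))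
                           (∈-image⁺ (transpose-< a<r b<r t<r))

segment≡image : ∀ {L n} .{{_ : NonZero L}} (w : Fin L → Fin n) s r →
  segment w s r ≡ image (λ t → w ((s + t) mod L)) r
segment≡image {suc L} w s zero    = refl
segment≡image {suc L} w s (suc r) = cong (⁅ w ((s + r) mod suc L) ⁆ ∪_) (segment≡image w s r)

GirthAtMost-mono : ∀ {k n} {G : KGraph k n} {m m'} → m ≤ m' → GirthAtMost G m → GirthAtMost G m'
GirthAtMost-mono m≤m' (ℓ , 3≤ℓ , ℓ≤m , cycle) = ℓ , 3≤ℓ , ≤-trans ℓ≤m m≤m' , cycle

<⇒≡suc[o+m] : ∀ {m n} → m < n → ∃[ o ] n ≡ suc (o + m)
<⇒≡suc[o+m] {m} {n} m<n = n ∸ suc m , sym (trans (sym (+-suc (n ∸ suc m) m)) (m∸n+n≡m m<n))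

module ClosedWalks {K n : ℕ} ⦃ _ : NonZero K ⦄ (G : KGraph (suc K) n) (linear : IsLinear G) where

  edgeOf : (ℕ → Fin n) → Subset n
  edgeOf f = image f (suc K)

  -- vertex t 0, …, vertex t K list the t-th edge, starting and ending at its
  -- junctions with the previous and the next edge.
  record ClosedWalk (ℓ : ℕ) : Set where
    field
      vertex   : ℕ → ℕ → Fin n
      2≤ℓ      : 2 ≤ ℓ
      link     : ∀ {t} → suc t < ℓ → vertex t K ≡ vertex (suc t) 0
      close    : ∀ {t} → suc t ≡ ℓ → vertex t K ≡ vertex 0 0
      isEdge   : ∀ {t} → t < ℓ → Edge G (edgeOf (vertex t))
      distinct : ∀ {s t} → s < ℓ → t < ℓ → edgeOf (vertex s) ≡ edgeOf (vertex t) → s ≡ t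

  ShorterWalk : ℕ → Set
  ShorterWalk ℓ = ∃[ ℓ' ] ℓ' < ℓ × ClosedWalk ℓ'

  0<K : 0 < K
  0<K = >-nonZero⁻¹ K

  K*i+K≡K*[1+i] : ∀ i → K * i + K ≡ K * suc i
  K*i+K≡K*[1+i] i = trans (+-comm (K * i) K) (sym (*-suc K i))

  K*ℓ≢0 : ∀ {ℓ} → 2 ≤ ℓ → NonZero (K * ℓ)
  K*ℓ≢0 {ℓ} 2≤ℓ = m*n≢0 K ℓ
    where instance
    ℓ≢0 : NonZero ℓ
    ℓ≢0 = >-nonZero (<-≤-trans z<s 2≤ℓ)

  module _ {ℓ : ℕ} (W : ClosedWalk ℓ) where
    open ClosedWalk W

    private instance
      L≢0 : NonZero (K * ℓ)
      L≢0 = K*ℓ≢0 2≤ℓ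

    vertex-injective : ∀ {t a b} → t < ℓ → a ≤ K → b ≤ K → vertex t a ≡ vertex t b → a ≡ b
    vertex-injective t<ℓ a≤K b≤K = injective-if-∣image∣≡ (uniform G _ (isEdge t<ℓ)) (s≤s a≤K) (s≤s b≤K)

    vertex≢last : ∀ {t s} → t < ℓ → s < K → vertex t s ≢ vertex t K
    vertex≢last t<ℓ s<K eq = <⇒≢ s<K (vertex-injective t<ℓ (<⇒≤ s<K) ≤-refl eq)

    ∈-edgeOf : ∀ {t s} → s ≤ K → vertex t s ∈ edgeOf (vertex t)
    ∈-edgeOf s≤K = ∈-image⁺ (s≤s s≤K)

    3≤length : 3 ≤ ℓ
    3≤length with m≤n⇒m<n∨m≡n 2≤ℓ
    ... | inj₁ 2<ℓ  = 2<ℓ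
    ... | inj₂ refl = ⊥-elim (vertex≢last 0<2 0<K (common-vertex-unique G linear (isEdge 0<2) (isEdge 1<2)
          (0≢1+n ∘ distinct 0<2 1<2)
          (∈-edgeOf z≤n) (subst (_∈ edgeOf (vertex 1)) (close refl) (∈-edgeOf ≤-refl))
          (∈-edgeOf ≤-refl) (subst (_∈ edgeOf (vertex 1)) (sym (link 1<2)) (∈-edgeOf z≤n))))
      where
      0<2 : 0 < 2
      0<2 = z<s
      1<2 : 1 < 2
      1<2 = ≤-refl

    last-edge-avoids-first : ∀ {j s s'} → suc j ≡ ℓ → 0 < j → s ≤ K → s' < K → vertex 0 s ≢ vertex j s'
    last-edge-avoids-first {j} 1+j≡ℓ 0<j s≤K s'<K eq =
      vertex≢last j<ℓ s'<K (common-vertex-unique G linear (isEdge j<ℓ) (isEdge 0<ℓ)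
        (>⇒≢ 0<j ∘ distinct j<ℓ 0<ℓ)
        (∈-edgeOf (<⇒≤ s'<K)) (subst (_∈ edgeOf (vertex 0)) eq (∈-edgeOf s≤K))
        (∈-edgeOf ≤-refl) (subst (_∈ edgeOf (vertex 0)) (sym (close 1+j≡ℓ)) (∈-edgeOf z≤n)))
      where
      j<ℓ : j < ℓ
      j<ℓ = ≤-reflexive 1+j≡ℓ
      0<ℓ : 0 < ℓ
      0<ℓ = <-trans 0<j j<ℓ

    vertexAt : ℕ → Fin n
    vertexAt j = vertex (j / K) (j % K)

    vertexAt-offset : ∀ i {t} → t < K → vertexAt (K * i + t) ≡ vertex i t
    vertexAt-offset i {t} t<K = cong₂ vertex quotient remainder
      where
      j≡t+i*K : K * i + t ≡ t + i * K
      j≡t+i*K = trans (+-comm (K * i) t) (cong (t +_) (*-comm K i))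
      quotient : (K * i + t) / K ≡ i
      quotient = begin
        (K * i + t) / K   ≡⟨ /-congˡ j≡t+i*K ⟩
        (t + i * K) / K   ≡⟨ +-distrib-/-∣ʳ t (n∣m*n i) ⟩
        t / K + i * K / K ≡⟨ cong₂ _+_ (m<n⇒m/n≡0 t<K) (m*n/n≡m i K) ⟩
        i                 ∎
      remainder : (K * i + t) % K ≡ t
      remainder = trans (%-congˡ j≡t+i*K) (trans ([m+kn]%n≡m%n t i K) (m<n⇒m%n≡m t<K))

    offset<length : ∀ {i t} → i < ℓ → t < K → K * i + t < K * ℓ
    offset<length {i} i<ℓ t<K = <-≤-trans (+-monoʳ-< (K * i) t<K)
      (≤-trans (≤-reflexive (K*i+K≡K*[1+i] i)) (*-monoʳ-≤ K i<ℓ))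

    vertexAt-% : ∀ {i t} → i < ℓ → t ≤ K → vertexAt ((K * i + t) % (K * ℓ)) ≡ vertex i t
    vertexAt-% {i} {t} i<ℓ t≤K with m≤n⇒m<n∨m≡n t≤K | m≤n⇒m<n∨m≡n i<ℓ
    ... | inj₁ t<K  | _ =
      trans (cong vertexAt (m<n⇒m%n≡m (offset<length i<ℓ t<K))) (vertexAt-offset i t<K)
    ... | inj₂ refl | inj₁ 1+i<ℓ = begin
      vertexAt ((K * i + K) % (K * ℓ)) ≡⟨ cong vertexAt (%-congˡ (K*i+K≡K*[1+i] i)) ⟩
      vertexAt (K * suc i % (K * ℓ))   ≡⟨ cong vertexAt (m<n⇒m%n≡m (*-monoʳ-< K 1+i<ℓ)) ⟩
      vertexAt (K * suc i)             ≡⟨ cong vertexAt (+-identityʳ (K * suc i)) ⟨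
      vertexAt (K * suc i + 0)         ≡⟨ vertexAt-offset (suc i) 0<K ⟩
      vertex (suc i) 0                 ≡⟨ link 1+i<ℓ ⟨
      vertex i K                       ∎
    ... | inj₂ refl | inj₂ 1+i≡ℓ = begin
      vertexAt ((K * i + K) % (K * ℓ)) ≡⟨ cong vertexAt (%-congˡ (trans (K*i+K≡K*[1+i] i) (cong (K *_) 1+i≡ℓ))) ⟩
      vertexAt (K * ℓ % (K * ℓ))       ≡⟨ cong vertexAt (n%n≡0 (K * ℓ)) ⟩
      vertexAt 0                       ≡⟨ cong vertexAt (trans (+-identityʳ (K * 0)) (*-zeroʳ K)) ⟨
      vertexAt (K * 0 + 0)             ≡⟨ vertexAt-offset 0 0<K ⟩
      vertex 0 0                       ≡⟨ close 1+i≡ℓ ⟨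
      vertex i K                       ∎

    trace : Fin (K * ℓ) → Fin n
    trace p = vertexAt (toℕ p)

    edgeSet-trace : ∀ {i} → i < ℓ → edgeSet (suc K) trace i ≡ edgeOf (vertex i)
    edgeSet-trace {i} i<ℓ = trans (segment≡image trace (K * i) (suc K))
      (image-cong (suc K) λ t<1+K → trans (cong vertexAt (toℕ-fromℕ< _)) (vertexAt-% i<ℓ (≤-pred t<1+K)))

    looseCycle : Injective _≡_ _≡_ trace → HasLooseCycle G ℓ
    looseCycle trace-injective =
      trace , trace-injective , λ i → subst (Edge G) (sym (edgeSet-trace (toℕ<n i))) (isEdge (toℕ<n i))

    module Shortcut {a d p p' : ℕ} (b<ℓ : suc (d + a) < ℓ) (p<K : p < K) (0<p' : 0 < p') (p'≤K : p' ≤ K)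
                    (chord : vertex a p ≡ vertex (suc (d + a)) p') where

      -- The shortcut runs through the edges a, …, a + d + 1, with the first one
      -- reordered to start at the chord vertex and the last one to end there.
      σ : ℕ → ℕ → ℕ
      σ zero    = transpose 0 p
      σ (suc t) with t ≟ d
      ... | yes _ = transpose p' K
      ... | no _  = id

      edgeOf-∘-σ : ∀ t (f : ℕ → Fin n) → edgeOf (f ∘ σ t) ≡ edgeOf f
      edgeOf-∘-σ zero    f = image-∘-transpose f z<s (m<n⇒m<1+n p<K)
      edgeOf-∘-σ (suc t) f with t ≟ d
      ... | yes _ = image-∘-transpose f (s≤s p'≤K) ≤-refl
      ... | no _  = refl

      σ-entry : σ 0 0 ≡ p
      σ-entry = transpose-matchˡ 0 p

      σ-exit : σ (suc d) K ≡ p'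
      σ-exit with d ≟ d
      ... | yes _   = transpose-matchʳ p' K
      ... | no d≢d  = contradiction refl d≢d

      σ-first : ∀ t → σ (suc t) 0 ≡ 0
      σ-first t with t ≟ d
      ... | yes _ = transpose-fix (<⇒≢ 0<p') (<⇒≢ 0<K)
      ... | no _  = refl

      σ-last : ∀ {t} → t ≤ d → σ t K ≡ K
      σ-last {zero}  _      = transpose-fix (>⇒≢ 0<K) (>⇒≢ p<K)
      σ-last {suc t} 1+t≤d with t ≟ d
      ... | yes refl = contradiction 1+t≤d (<-irrefl refl)
      ... | no _     = refl

      vertex' : ℕ → ℕ → Fin n
      vertex' t = vertex (t + a) ∘ σ t

      within : ∀ {t} → t < suc (suc d) → t + a < ℓ
      within t<2+d = ≤-<-trans (+-monoˡ-≤ _ (≤-pred t<2+d)) b<ℓ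

      walk : ClosedWalk (suc (suc d))
      walk = record
        { vertex   = vertex'
        ; 2≤ℓ      = s≤s (s≤s z≤n)
        ; link     = λ {t} 1+t<2+d → begin
            vertex (t + a) (σ t K)    ≡⟨ cong (vertex (t + a)) (σ-last (≤-pred (≤-pred 1+t<2+d))) ⟩
            vertex (t + a) K          ≡⟨ link (within 1+t<2+d) ⟩
            vertex (suc t + a) 0      ≡⟨ cong (vertex (suc t + a)) (σ-first t) ⟨
            vertex' (suc t) 0         ∎
        ; close    = λ { refl → begin
            vertex (suc d + a) (σ (suc d) K) ≡⟨ cong (vertex (suc d + a)) σ-exit ⟩
            vertex (suc (d + a)) p'          ≡⟨ chord ⟨
            vertex a p                       ≡⟨ cong (vertex a) σ-entry ⟨
            vertex' 0 0                      ∎ }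
        ; isEdge   = λ {t} t<2+d → subst (Edge G) (sym (edgeOf-∘-σ t _)) (isEdge (within t<2+d))
        ; distinct = λ {s} {t} s<2+d t<2+d eq → +-cancelʳ-≡ a s t (distinct (within s<2+d) (within t<2+d)
            (trans (sym (edgeOf-∘-σ s _)) (trans eq (edgeOf-∘-σ t _))))
        }

    chord-shorter : ∀ {i d s s'} → suc (d + i) < ℓ → s < K → s' < K →
      vertex i s ≡ vertex (suc (d + i)) s' → suc (suc d) < ℓ
    chord-shorter {suc i} {d} j<ℓ _ _ _ = ≤-trans (s≤s (s≤s (m<m+n d z<s))) j<ℓ
    chord-shorter {zero}  {d} j<ℓ s<K s'<K eq with m≤n⇒m<n∨m≡n j<ℓ
    ... | inj₁ 1+j<ℓ = subst (λ e → suc (suc e) < ℓ) (+-identityʳ d) 1+j<ℓ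
    ... | inj₂ 1+j≡ℓ = contradiction eq (last-edge-avoids-first 1+j≡ℓ z<s (<⇒≤ s<K) s'<K)

    vertex-collision : ∀ {i j s s'} → i < j → j < ℓ → s < K → s' < K → vertex i s ≡ vertex j s' → ShorterWalk ℓ
    -- A repetition at the first vertex of edge j + 1 is one at the last vertex of edge j.
    vertex-collision {i} {suc j} {s} {zero} i<1+j 1+j<ℓ s<K _ eq
      with m≤n⇒m<n∨m≡n (≤-pred i<1+j)
    ... | inj₂ refl = contradiction (trans eq (sym (link 1+j<ℓ))) (vertex≢last (<-trans i<1+j 1+j<ℓ) s<K)
    ... | inj₁ i<j with <⇒≡suc[o+m] i<j
    ...   | d , refl = suc (suc d) , ≤-trans (s≤s (s≤s (s≤s (m≤m+n d i)))) 1+j<ℓ ,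
                       Shortcut.walk (<-trans ≤-refl 1+j<ℓ) s<K 0<K ≤-refl (trans eq (sym (link 1+j<ℓ)))
    vertex-collision {i} {j} {s} {suc _} i<j j<ℓ s<K s'<K eq with <⇒≡suc[o+m] i<j
    ... | d , refl = suc (suc d) , chord-shorter j<ℓ s<K s'<K eq , Shortcut.walk j<ℓ s<K z<s (<⇒≤ s'<K) eq

    quotient<length : ∀ p → toℕ p / K < ℓ
    quotient<length p = m<n*o⇒m/o<n (subst (toℕ p <_) (*-comm K ℓ) (toℕ<n p))

    trace-collision : ∀ {p q} → p ≢ q → trace p ≡ trace q → ShorterWalk ℓ
    trace-collision {p} {q} p≢q tp≡tq with <-cmp (toℕ p / K) (toℕ q / K)
    ... | tri< i<j _ _ = vertex-collision i<j (quotient<length q) (m%n<n _ K) (m%n<n _ K) tp≡tq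
    ... | tri> _ _ j<i = vertex-collision j<i (quotient<length p) (m%n<n _ K) (m%n<n _ K) (sym tp≡tq)
    ... | tri≈ _ i≡j _ = contradiction (toℕ-injective (begin
      toℕ p                      ≡⟨ m≡m%n+[m/n]*n (toℕ p) K ⟩
      toℕ p % K + toℕ p / K * K  ≡⟨ cong₂ (λ s i → s + i * K) s≡s' i≡j ⟩
      toℕ q % K + toℕ q / K * K  ≡⟨ m≡m%n+[m/n]*n (toℕ q) K ⟨
      toℕ q                      ∎)) p≢q
      where
      s≡s' : toℕ p % K ≡ toℕ q % K
      s≡s' = vertex-injective (quotient<length p) (<⇒≤ (m%n<n _ K)) (<⇒≤ (m%n<n _ K))
               (trans tp≡tq (cong (λ i → vertex i (toℕ q % K)) (sym i≡j)))

  girth≤length : ∀ {ℓ} → ClosedWalk ℓ → GirthAtMost G ℓ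
  girth≤length {ℓ} = <-rec (λ ℓ → ClosedWalk ℓ → GirthAtMost G ℓ) step ℓ
    where
    step : ∀ ℓ → (∀ {ℓ'} → ℓ' < ℓ → ClosedWalk ℓ' → GirthAtMost G ℓ') → ClosedWalk ℓ → GirthAtMost G ℓ
    step ℓ shorter⇒girth W with injective-or-collision (trace W)
    ... | inj₁ injective = ℓ , 3≤length W , ≤-refl , looseCycle W injective
    ... | inj₂ (p , q , p≢q , tp≡tq) with trace-collision W p≢q tp≡tq
    ...   | ℓ' , ℓ'<ℓ , W' = GirthAtMost-mono {G = G} (<⇒≤ ℓ'<ℓ) (shorter⇒girth ℓ'<ℓ W')

  fromSequence : ∀ {ℓ} → 2 ≤ ℓ → (v : Fin (K * ℓ) → Fin n) →
    (∀ (i : Fin ℓ) → Edge G (edgeSet (suc K) v (toℕ i))) →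
    (∀ (i j : Fin ℓ) → i ≢ j → edgeSet (suc K) v (toℕ i) ≢ edgeSet (suc K) v (toℕ j)) →
    ClosedWalk ℓ
  fromSequence {ℓ} 2≤ℓ v isEdge distinct = record
    { vertex   = vertex
    ; 2≤ℓ      = 2≤ℓ
    ; link     = λ {t} _ → cong (λ j → v (j mod (K * ℓ))) (trans (K*i+K≡K*[1+i] t) (sym (+-identityʳ _)))
    ; close    = λ {t} 1+t≡ℓ → cong v (fromℕ<-cong _ _ (begin
        (K * t + K) % (K * ℓ) ≡⟨ %-congˡ (trans (K*i+K≡K*[1+i] t) (cong (K *_) 1+t≡ℓ)) ⟩
        K * ℓ % (K * ℓ)       ≡⟨ n%n≡0 (K * ℓ) ⟩
        0                     ≡⟨ m<n⇒m%n≡m (>-nonZero⁻¹ (K * ℓ)) ⟨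
        0 % (K * ℓ)           ≡⟨ %-congˡ (trans (+-identityʳ (K * 0)) (*-zeroʳ K)) ⟨
        (K * 0 + 0) % (K * ℓ) ∎) _ _)
    ; isEdge   = λ t<ℓ → subst (Edge G) (edgeSet-fromℕ< t<ℓ) (isEdge (fromℕ< t<ℓ))
    ; distinct = λ {s} {t} s<ℓ t<ℓ eq → decidable-stable (s ≟ t) λ s≢t →
        distinct (fromℕ< s<ℓ) (fromℕ< t<ℓ) (s≢t ∘ fromℕ<-injective s t s<ℓ t<ℓ)
          (trans (edgeSet-fromℕ< s<ℓ) (trans eq (sym (edgeSet-fromℕ< t<ℓ))))
    }
    where
    instance
      L≢0 : NonZero (K * ℓ)
      L≢0 = K*ℓ≢0 2≤ℓ
    vertex : ℕ → ℕ → Fin n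
    vertex t s = v ((K * t + s) mod (K * ℓ))
    edgeSet-fromℕ< : ∀ {t} (t<ℓ : t < ℓ) → edgeSet (suc K) v (toℕ (fromℕ< t<ℓ)) ≡ edgeOf (vertex t)
    edgeSet-fromℕ< {t} t<ℓ = trans (cong (edgeSet (suc K) v) (toℕ-fromℕ< t<ℓ)) (segment≡image v (K * t) (suc K))

lemma6p1 : (k m n : ℕ) → 3 ≤ k → 3 ≤ m → (G : KGraph k n) →
    IsLinear G → IsKPartite G →
    (v : Fin ((k ∸ 1) * m) → Fin n) →
    (∀ (i : Fin m) → Edge G (edgeSet k v (toℕ i))) →
    (∀ (i j : Fin m) → i ≢ j → edgeSet k v (toℕ i) ≢ edgeSet k v (toℕ j)) →
    GirthAtMost G m
lemma6p1 (suc (suc K)) m n _ 3≤m G linear _ v isEdge distinct =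
  girth≤length (fromSequence (≤-trans (n≤1+n 2) 3≤m) v isEdge distinct)
  where open ClosedWalks G linear
lemma6p1 (suc zero) _ _ (s≤s ()) _ _ _ _ _ _ _
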